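{- Let $t$ and $u$ be integers with $\frac{t}{2}\le u\le t-1$. Then there exists a bijection $\alpha_u:[t]\to[t]$ such that (1) $\alpha_u(i+u)=\alpha_u(i)-1$ for all $i\in[t-u]$, and (2) $\alpha_u(i+u+1)=\alpha_u(i)+1$ for all $i\in[t-u-1]$.
   Context: For an integer $N$, $[N]=\{0,1,\dots,N-1\}$. -}

module Defs where

open import Data.Nat using (ℕ; _∸_; _<_; _≤_)
open import Data.Nat.Properties using (<-≤-trans; m∸n≤m; ≤-trans)

i<t∸u⇒i<t : ∀ {i} (t u : ℕ) → i < t ∸ u → i < t
i<t∸u⇒i<t t u p = <-≤-trans p (m∸n≤m t u)

i<t∸u∸1⇒i<t : ∀ {i} (t u : ℕ) → i < t ∸ u ∸ 1 → i < t
i<t∸u∸1⇒i<t t u p = <-≤-trans p (≤-trans (m∸n≤m (t ∸ u) 1) (m∸n≤m t u))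

-- With s = t − u ≤ u, split [t] into a head [0, s), a middle [s, u) and a tail [u, t) of length s.
-- Let α send the i-th head element to 2i + 1, the i-th tail element u + i to 2i, and shift the middle
-- up by s onto [2s, t). Head and tail thus interleave on [0, 2s), which is exactly what (1) and (2) say.
module Submission where

open import Defs
open import Data.Nat using (ℕ; _+_; _*_; _∸_; _≤_; _<_; suc; zero; _<?_)
open import Data.Nat.Properties
open import Data.Fin using (Fin; toℕ; fromℕ<)
open import Data.Fin.Properties using (toℕ-fromℕ<; toℕ-injective; toℕ<n)
open import Data.Product using (Σ; _×_; _,_)
open import Function.Definitions using (Bijective)
open import Function.Consequences.Propositional
  using (inverseᵇ⇒bijective; strictlyInverseˡ⇒inverseˡ; strictlyInverseʳ⇒inverseʳ)
open import Relation.Binary.PropositionalEquality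
open import Relation.Nullary using (yes; no)
open import Relation.Nullary.Negation using (contradiction)

module _ {n : ℕ} where

  restrict : (f : ℕ → ℕ) → (∀ {j} → j < n → f j < n) → Fin n → Fin n
  restrict f f< x = fromℕ< (f< (toℕ<n x))

  toℕ-restrict : ∀ f (f< : ∀ {j} → j < n → f j < n) x → toℕ (restrict f f< x) ≡ f (toℕ x)
  toℕ-restrict f f< x = toℕ-fromℕ< (f< (toℕ<n x))

  toℕ-restrict-fromℕ< : ∀ f (f< : ∀ {j} → j < n → f j < n) {j} (j<n : j < n) →
                        toℕ (restrict f f< (fromℕ< j<n)) ≡ f j
  toℕ-restrict-fromℕ< f f< j<n = trans (toℕ-restrict f f< _) (cong f (toℕ-fromℕ< j<n))

  restrict-inverse : ∀ f g (f< : ∀ {j} → j < n → f j < n) (g< : ∀ {j} → j < n → g j < n) →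
                     (∀ {j} → j < n → g (f j) ≡ j) →
                     ∀ x → restrict g g< (restrict f f< x) ≡ x
  restrict-inverse f g f< g< gf x = toℕ-injective (begin
    toℕ (restrict g g< (restrict f f< x)) ≡⟨ toℕ-restrict g g< _ ⟩
    g (toℕ (restrict f f< x))             ≡⟨ cong g (toℕ-restrict f f< x) ⟩
    g (f (toℕ x))                         ≡⟨ gf (toℕ<n x) ⟩
    toℕ x                                 ∎)
    where open ≡-Reasoning

  restrict-bijective : ∀ f g (f< : ∀ {j} → j < n → f j < n) (g< : ∀ {j} → j < n → g j < n) →
                       (∀ {j} → j < n → g (f j) ≡ j) → (∀ {v} → v < n → f (g v) ≡ v) →
                       Bijective _≡_ _≡_ (restrict f f<)
  restrict-bijective f g f< g< gf fg = inverseᵇ⇒bijective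
    ( strictlyInverseˡ⇒inverseˡ (restrict f f<) (restrict-inverse g f g< f< fg)
    , strictlyInverseʳ⇒inverseʳ (restrict f f<) (restrict-inverse f g f< g< gf))

data Parity : ℕ → Set where
  even : ∀ q → Parity (2 * q)
  odd  : ∀ q → Parity (suc (2 * q))

parity : ∀ n → Parity n
parity zero = even 0
parity (suc n) with parity n
... | even q = odd q
... | odd q  = subst Parity (*-suc 2 q) (even (suc q))

1+2q<2s : ∀ {q s} → q < s → suc (2 * q) < 2 * s
1+2q<2s {q} {s} q<s = subst (_≤ 2 * s) (*-suc 2 q) (*-monoʳ-≤ 2 q<s)

2*s≡s+s : ∀ s → 2 * s ≡ s + s
2*s≡s+s s = cong (s +_) (+-identityʳ s)

module Shuffle (t u : ℕ) (u≤t : u ≤ t) (t≤2u : t ≤ 2 * u) where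

  s : ℕ
  s = t ∸ u

  s≤u : s ≤ u
  s≤u = ≤-trans (m≤n+o⇒m∸n≤o t u t≤2u) (≤-reflexive (+-identityʳ u))

  u+s≡t : u + s ≡ t
  u+s≡t = m+[n∸m]≡n u≤t

  shuffle : ℕ → ℕ
  shuffle j with j <? s
  ... | yes _ = suc (2 * j)
  ... | no _ with j <? u
  ...   | yes _ = j + s
  ...   | no _  = 2 * (j ∸ u)

  shuffle-head : ∀ {j} → j < s → shuffle j ≡ suc (2 * j)
  shuffle-head {j} j<s with j <? s
  ... | yes _   = refl
  ... | no j≮s = contradiction j<s j≮s

  shuffle-middle : ∀ {j} → s ≤ j → j < u → shuffle j ≡ j + s
  shuffle-middle {j} s≤j j<u with j <? s
  ... | yes j<s = contradiction s≤j (<⇒≱ j<s)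
  ... | no _ with j <? u
  ...   | yes _   = refl
  ...   | no j≮u = contradiction j<u j≮u

  shuffle-tail : ∀ i → shuffle (i + u) ≡ 2 * i
  shuffle-tail i with i + u <? s
  ... | yes i+u<s = contradiction (≤-trans s≤u (m≤n+m u i)) (<⇒≱ i+u<s)
  ... | no _ with i + u <? u
  ...   | yes i+u<u = contradiction (m≤n+m u i) (<⇒≱ i+u<u)
  ...   | no _      = cong (2 *_) (m+n∸n≡m i u)

  unweave : ℕ → ℕ
  unweave zero = u
  unweave (suc zero) = 0
  unweave (suc (suc v)) = suc (unweave v)

  unweave-even : ∀ q → unweave (2 * q) ≡ q + u
  unweave-even zero = refl
  unweave-even (suc q) = trans (cong unweave (*-suc 2 q)) (cong suc (unweave-even q))

  unweave-odd : ∀ q → unweave (suc (2 * q)) ≡ q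
  unweave-odd zero = refl
  unweave-odd (suc q) = trans (cong (λ v → unweave (suc v)) (*-suc 2 q)) (cong suc (unweave-odd q))

  unshuffle : ℕ → ℕ
  unshuffle v with v <? 2 * s
  ... | yes _ = unweave v
  ... | no _  = v ∸ s

  unshuffle-interleaved : ∀ {v} → v < 2 * s → unshuffle v ≡ unweave v
  unshuffle-interleaved {v} v<2s with v <? 2 * s
  ... | yes _    = refl
  ... | no v≮2s = contradiction v<2s v≮2s

  unshuffle-odd : ∀ {q} → q < s → unshuffle (suc (2 * q)) ≡ q
  unshuffle-odd {q} q<s = trans (unshuffle-interleaved (1+2q<2s q<s)) (unweave-odd q)

  unshuffle-even : ∀ {q} → q < s → unshuffle (2 * q) ≡ q + u
  unshuffle-even {q} q<s = trans (unshuffle-interleaved (<⇒≤ (1+2q<2s q<s))) (unweave-even q)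

  unshuffle-shifted : ∀ {j} → s ≤ j → unshuffle (j + s) ≡ j
  unshuffle-shifted {j} s≤j with j + s <? 2 * s
  ... | yes j+s<2s = contradiction 2*s≤j+s (<⇒≱ j+s<2s)
    where
    2*s≤j+s : 2 * s ≤ j + s
    2*s≤j+s = subst (_≤ j + s) (sym (2*s≡s+s s)) (+-monoˡ-≤ s s≤j)
  ... | no _       = m+n∸n≡m j s

  data Position : ℕ → Set where
    head   : ∀ {j} → j < s → Position j
    middle : ∀ {j} → s ≤ j → j < u → Position j
    tail   : ∀ {i} → i < s → Position (i + u)

  position : ∀ {j} → j < t → Position j
  position {j} j<t with j <? s
  ... | yes j<s = head j<s
  ... | no j≮s with j <? u
  ...   | yes j<u = middle (≮⇒≥ j≮s) j<u
  ...   | no j≮u  = subst Position (m∸n+n≡m u≤j) (tail j∸u<s)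
    where
    u≤j : u ≤ j
    u≤j = ≮⇒≥ j≮u
    j∸u<s : j ∸ u < s
    j∸u<s = ∸-monoˡ-< j<t u≤j

  data Value : ℕ → Set where
    odd     : ∀ {q} → q < s → Value (suc (2 * q))
    even    : ∀ {q} → q < s → Value (2 * q)
    shifted : ∀ {j} → s ≤ j → j < u → Value (j + s)

  value : ∀ {v} → v < t → Value v
  value {v} v<t with v <? 2 * s
  ... | yes v<2s with parity v
  ...   | even q = even (*-cancelˡ-< 2 q s v<2s)
  ...   | odd q  = odd (*-cancelˡ-< 2 q s (<⇒≤ v<2s))
  value {v} v<t | no v≮2s = subst Value (m∸n+n≡m s≤v) (shifted s≤v∸s v∸s<u)
    where
    s+s≤v : s + s ≤ v
    s+s≤v = subst (_≤ v) (2*s≡s+s s) (≮⇒≥ v≮2s)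
    s≤v : s ≤ v
    s≤v = m+n≤o⇒m≤o s s+s≤v
    s≤v∸s : s ≤ v ∸ s
    s≤v∸s = m+n≤o⇒m≤o∸n s s+s≤v
    v∸s<u : v ∸ s < u
    v∸s<u = subst (v ∸ s <_) (m∸[m∸n]≡n u≤t) (∸-monoˡ-< v<t s≤v)

  1+2q<t : ∀ {q} → q < s → suc (2 * q) < t
  1+2q<t q<s = <-≤-trans (1+2q<2s q<s) (begin
    2 * s ≡⟨ 2*s≡s+s s ⟩
    s + s ≤⟨ +-monoˡ-≤ s s≤u ⟩
    u + s ≡⟨ u+s≡t ⟩
    t     ∎)
    where open ≤-Reasoning

  shuffle-< : ∀ {j} → j < t → shuffle j < t
  shuffle-< j<t with position j<t
  ... | head j<s       = subst (_< t) (sym (shuffle-head j<s)) (1+2q<t j<s)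
  ... | middle s≤j j<u = subst (_< t) (sym (shuffle-middle s≤j j<u))
                           (<-≤-trans (+-monoˡ-< s j<u) (≤-reflexive u+s≡t))
  ... | tail {i} i<s   = subst (_< t) (sym (shuffle-tail i)) (<⇒≤ (1+2q<t i<s))

  unshuffle-< : ∀ {v} → v < t → unshuffle v < t
  unshuffle-< v<t with value v<t
  ... | odd q<s         = subst (_< t) (sym (unshuffle-odd q<s)) (<-≤-trans q<s (m∸n≤m t u))
  ... | even q<s        = subst (_< t) (sym (unshuffle-even q<s))
                            (<-≤-trans (+-monoˡ-< u q<s) (≤-reflexive (m∸n+n≡m u≤t)))
  ... | shifted s≤j j<u = subst (_< t) (sym (unshuffle-shifted s≤j)) (<-≤-trans j<u u≤t)

  unshuffle-shuffle : ∀ {j} → j < t → unshuffle (shuffle j) ≡ j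
  unshuffle-shuffle j<t with position j<t
  ... | head j<s       = trans (cong unshuffle (shuffle-head j<s)) (unshuffle-odd j<s)
  ... | middle s≤j j<u = trans (cong unshuffle (shuffle-middle s≤j j<u)) (unshuffle-shifted s≤j)
  ... | tail {i} i<s   = trans (cong unshuffle (shuffle-tail i)) (unshuffle-even i<s)

  shuffle-unshuffle : ∀ {v} → v < t → shuffle (unshuffle v) ≡ v
  shuffle-unshuffle v<t with value v<t
  ... | odd q<s         = trans (cong shuffle (unshuffle-odd q<s)) (shuffle-head q<s)
  ... | even {q} q<s    = trans (cong shuffle (unshuffle-even q<s)) (shuffle-tail q)
  ... | shifted s≤j j<u = trans (cong shuffle (unshuffle-shifted s≤j)) (shuffle-middle s≤j j<u)

  suc-shuffle-tail : ∀ {i} → i < s → suc (shuffle (i + u)) ≡ shuffle i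
  suc-shuffle-tail {i} i<s = trans (cong suc (shuffle-tail i)) (sym (shuffle-head i<s))

  shuffle-suc-tail : ∀ {i} → i < s → shuffle (suc i + u) ≡ suc (shuffle i)
  shuffle-suc-tail {i} i<s = begin
    shuffle (suc i + u) ≡⟨ shuffle-tail (suc i) ⟩
    2 * suc i           ≡⟨ *-suc 2 i ⟩
    suc (suc (2 * i))   ≡⟨ cong suc (shuffle-head i<s) ⟨
    suc (shuffle i)     ∎
    where open ≡-Reasoning

lemma28 : (t u : ℕ) → t ≤ 2 * u → u < t →
    Σ (Fin t → Fin t) λ α → Bijective _≡_ _≡_ α
      × ((i : ℕ) (p : i < t ∸ u) (q : i + u < t) →
           suc (toℕ (α (fromℕ< q))) ≡ toℕ (α (fromℕ< (i<t∸u⇒i<t t u p))))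
      × ((i : ℕ) (p : i < t ∸ u ∸ 1) (q : i + u + 1 < t) →
           toℕ (α (fromℕ< q)) ≡ suc (toℕ (α (fromℕ< (i<t∸u∸1⇒i<t t u p)))))
lemma28 t u t≤2u u<t =
  α , restrict-bijective shuffle unshuffle shuffle-< unshuffle-< unshuffle-shuffle shuffle-unshuffle
    , (λ i p q → begin
        suc (toℕ (α (fromℕ< q))) ≡⟨ cong suc (toℕ-α q) ⟩
        suc (shuffle (i + u))    ≡⟨ suc-shuffle-tail p ⟩
        shuffle i                ≡⟨ toℕ-α (i<t∸u⇒i<t t u p) ⟨
        toℕ (α (fromℕ< _))       ∎)
    , (λ i p q → begin
        toℕ (α (fromℕ< q))       ≡⟨ toℕ-α q ⟩
        shuffle (i + u + 1)      ≡⟨ cong shuffle (+-comm (i + u) 1) ⟩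
        shuffle (suc i + u)      ≡⟨ shuffle-suc-tail (<-≤-trans p (m∸n≤m s 1)) ⟩
        suc (shuffle i)          ≡⟨ cong suc (toℕ-α (i<t∸u∸1⇒i<t t u p)) ⟨
        suc (toℕ (α (fromℕ< _))) ∎)
  where
  open ≡-Reasoning
  open Shuffle t u (<⇒≤ u<t) t≤2u
  α : Fin t → Fin t
  α = restrict shuffle shuffle-<
  toℕ-α : ∀ {j} (j<t : j < t) → toℕ (α (fromℕ< j<t)) ≡ shuffle j
  toℕ-α = toℕ-restrict-fromℕ< shuffle shuffle-<
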